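{- For all finite multisets $\Gamma,\Delta$ of formulas: $\Gamma\Rightarrow\Delta$ is derivable in $\mathsf{GWF\widehat{C}}$ if and only if $\vdash_{\mathsf{WF\widehat{C}}}\bigwedge\Gamma\rightarrow\bigvee\Delta$.
   Context: Formulas are built from a countable set of propositional atoms and $\bot$ using $\wedge,\vee,\rightarrow$; $A\leftrightarrow B$ abbreviates $(A\rightarrow B)\wedge(B\rightarrow A)$. $\bigwedge\Gamma$, $\bigvee\Delta$ are the conjunction/disjunction of the formulas of the multiset (empty conjunction read as $\bot\rightarrow\bot$, empty disjunction as $\bot$). Sequent calculus $\mathsf{GWF\widehat{C}}$ (sequents $\Gamma\Rightarrow\Delta$, finite multisets, $p$ atomic): (Ax) $p,\Gamma\Rightarrow\Delta,p$; ($\bot_L$) $\bot,\Gamma\Rightarrow\Delta$; ($\wedge_L$) from $A,B,\Gamma\Rightarrow\Delta$ infer $A\wedge B,\Gamma\Rightarrow\Delta$; ($\wedge_R$) from $\Gamma\Rightarrow\Delta,A$ and $\Gamma\Rightarrow\Delta,B$ infer $\Gamma\Rightarrow\Delta,A\wedge B$; ($\vee_L$) from $A,\Gamma\Rightarrow\Delta$ and $B,\Gamma\Rightarrow\Delta$ infer $A\vee B,\Gamma\Rightarrow\Delta$; ($\vee_R$) from $\Gamma\Rightarrow\Delta,A,B$ infer $\Gamma\Rightarrow\Delta,A\vee B$; ($\rightarrow_R$) from $A\Rightarrow B$ infer $\Gamma\Rightarrow A\rightarrow B,\Delta$; ($\rightarrow_{LR}$) from $A\Rightarrow B$, $B\Rightarrow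 A$, $C\Rightarrow D$, $D\Rightarrow C$ infer $\Gamma,A\rightarrow C\Rightarrow B\rightarrow D,\Delta$; (Cut) from $\Gamma\Rightarrow D,\Delta$ and $D,\Gamma'\Rightarrow\Delta'$ infer $\Gamma,\Gamma'\Rightarrow\Delta,\Delta'$; ($\rightarrow_{\widehat{C}}$) from $A\Rightarrow B$ infer $\Gamma,C\rightarrow A\Rightarrow C\rightarrow B,\Delta$. Hilbert system $\mathsf{WF}$: axioms all instances of $A\rightarrow(A\vee B)$; $B\rightarrow(A\vee B)$; $(A\wedge B)\rightarrow A$; $(A\wedge B)\rightarrow B$; $A\wedge(B\vee C)\rightarrow(A\wedge B)\vee(A\wedge C)$; $A\rightarrow A$; $\bot\rightarrow A$; rules: from $A$, $A\rightarrow B$ infer $B$; from $A$ infer $B\rightarrow A$; from $A\rightarrow B$, $B\rightarrow C$ infer $A\rightarrow C$; from $A\rightarrow B$, $A\rightarrow C$ infer $A\rightarrow(B\wedge C)$; from $A\rightarrow C$, $B\rightarrow C$ infer $(A\vee B)\rightarrow C$; from $A$, $B$ infer $A\wedge B$; from $A\leftrightarrow B$, $C\leftrightarrow D$ infer $(A\rightarrow C)\leftrightarrow(B\rightarrow D)$. $\mathsf{WF\widehat{C}}$ is $\mathsf{WF}$ plus all instances of the axiom $(A\rightarrow B\wedge C)\rightarrow(A\rightarrow B)\wedge(A\rightarrow C)$. -}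

module Defs where

open import Data.Nat using (ℕ)
open import Data.List using (List; []; _∷_; _++_)
open import Data.List.Relation.Binary.Permutation.Propositional using (_↭_)

infixr 6 _∧_
infixr 5 _∨_
infixr 4 _⇒_

data Formula : Set where
  atom : ℕ → Formula
  ⊥'   : Formula
  _∧_  : Formula → Formula → Formula
  _∨_  : Formula → Formula → Formula
  _⇒_  : Formula → Formula → Formula

_⇔_ : Formula → Formula → Formula
A ⇔ B = (A ⇒ B) ∧ (B ⇒ A)

-- Finite multisets are represented by lists, considered up to permutation
-- (see the rule `perm` below).
-- Big conjunction / disjunction; empty conjunction is ⊥ → ⊥, empty disjunction is ⊥.
⋀ : List Formula → Formula
⋀ []           = ⊥' ⇒ ⊥'
⋀ (A ∷ [])     = A
⋀ (A ∷ B ∷ Γ)  = A ∧ ⋀ (B ∷ Γ)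

⋁ : List Formula → Formula
⋁ []           = ⊥'
⋁ (A ∷ [])     = A
⋁ (A ∷ B ∷ Γ)  = A ∨ ⋁ (B ∷ Γ)

infix 3 _⊢G_
-- Principal formulas are written at the head of the
-- antecedent/succedent list; `perm` makes derivability invariant under
-- permutation, so lists faithfully represent multisets.
data _⊢G_ : List Formula → List Formula → Set where
  perm  : ∀ {Γ Γ' Δ Δ'} → Γ ↭ Γ' → Δ ↭ Δ' → Γ ⊢G Δ → Γ' ⊢G Δ'
  ax    : ∀ {p Γ Δ} → atom p ∷ Γ ⊢G atom p ∷ Δ
  ⊥L    : ∀ {Γ Δ} → ⊥' ∷ Γ ⊢G Δ
  ∧L    : ∀ {A B Γ Δ} → A ∷ B ∷ Γ ⊢G Δ → (A ∧ B) ∷ Γ ⊢G Δ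
  ∧R    : ∀ {A B Γ Δ} → Γ ⊢G A ∷ Δ → Γ ⊢G B ∷ Δ → Γ ⊢G (A ∧ B) ∷ Δ
  ∨L    : ∀ {A B Γ Δ} → A ∷ Γ ⊢G Δ → B ∷ Γ ⊢G Δ → (A ∨ B) ∷ Γ ⊢G Δ
  ∨R    : ∀ {A B Γ Δ} → Γ ⊢G A ∷ B ∷ Δ → Γ ⊢G (A ∨ B) ∷ Δ
  ⇒R    : ∀ {A B Γ Δ} → A ∷ [] ⊢G B ∷ [] → Γ ⊢G (A ⇒ B) ∷ Δ
  ⇒LR   : ∀ {A B C D Γ Δ} →
          A ∷ [] ⊢G B ∷ [] → B ∷ [] ⊢G A ∷ [] →
          C ∷ [] ⊢G D ∷ [] → D ∷ [] ⊢G C ∷ [] →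
          (A ⇒ C) ∷ Γ ⊢G (B ⇒ D) ∷ Δ
  cut   : ∀ {D Γ Γ' Δ Δ'} → Γ ⊢G D ∷ Δ → D ∷ Γ' ⊢G Δ' → Γ ++ Γ' ⊢G Δ ++ Δ'
  ⇒Ĉ    : ∀ {A B C Γ Δ} → A ∷ [] ⊢G B ∷ [] → (C ⇒ A) ∷ Γ ⊢G (C ⇒ B) ∷ Δ

infix 3 ⊢WFĈ_
-- Hilbert system WFĈ = WF + (A → B ∧ C) → (A → B) ∧ (A → C).
data ⊢WFĈ_ : Formula → Set where
  a-∨₁   : ∀ {A B} → ⊢WFĈ A ⇒ A ∨ B
  a-∨₂   : ∀ {A B} → ⊢WFĈ B ⇒ A ∨ B
  a-∧₁   : ∀ {A B} → ⊢WFĈ A ∧ B ⇒ A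
  a-∧₂   : ∀ {A B} → ⊢WFĈ A ∧ B ⇒ B
  a-dist : ∀ {A B C} → ⊢WFĈ A ∧ (B ∨ C) ⇒ (A ∧ B) ∨ (A ∧ C)
  a-id   : ∀ {A} → ⊢WFĈ A ⇒ A
  a-⊥    : ∀ {A} → ⊢WFĈ ⊥' ⇒ A
  a-Ĉ    : ∀ {A B C} → ⊢WFĈ (A ⇒ B ∧ C) ⇒ (A ⇒ B) ∧ (A ⇒ C)
  r-mp   : ∀ {A B} → ⊢WFĈ A → ⊢WFĈ A ⇒ B → ⊢WFĈ B
  r-wk   : ∀ {A B} → ⊢WFĈ A → ⊢WFĈ B ⇒ A
  r-tr   : ∀ {A B C} → ⊢WFĈ A ⇒ B → ⊢WFĈ B ⇒ C → ⊢WFĈ A ⇒ C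
  r-∧    : ∀ {A B C} → ⊢WFĈ A ⇒ B → ⊢WFĈ A ⇒ C → ⊢WFĈ A ⇒ B ∧ C
  r-∨    : ∀ {A B C} → ⊢WFĈ A ⇒ C → ⊢WFĈ B ⇒ C → ⊢WFĈ A ∨ B ⇒ C
  r-adj  : ∀ {A B} → ⊢WFĈ A → ⊢WFĈ B → ⊢WFĈ A ∧ B
  r-⇔    : ∀ {A B C D} → ⊢WFĈ A ⇔ B → ⊢WFĈ C ⇔ D → ⊢WFĈ (A ⇒ C) ⇔ (B ⇒ D)

{-# OPTIONS --safe #-}
module Submission where

-- For completeness every theorem F of
-- WFĈ becomes a derivation of [] ⊢G [F]; modus ponens and the rules with
-- implicational premisses then need the inversion of ⇒R, from
-- [] ⊢G [A ⇒ B] to [A] ⊢G [B].  Instead of cut elimination this comes from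
-- a realizability reading of sequents: a realizer of A ⇒ B is a derivation
-- of [A] ⊢G [B], and every rule of GWFĈ, cut included, maps realizers of
-- the antecedent to a realizer of some formula of the succedent (for ⇒LR
-- and ⇒Ĉ by composing derivations with cut).

open import Defs
open import Data.Empty using () renaming (⊥ to Empty)
open import Data.List using (List; []; _∷_; _++_)
open import Data.List.Membership.Propositional using (_∈_)
open import Data.List.Relation.Binary.Permutation.Propositional
  using (↭-refl; ↭-sym; ↭-swap)
open import Data.List.Relation.Binary.Permutation.Propositional.Properties
  using (All-resp-↭; Any-resp-↭; ∷↭∷ʳ; ++-identityʳ)
open import Data.List.Relation.Binary.Subset.Propositional using (_⊆_)
open import Data.List.Relation.Binary.Subset.Propositional.Properties
  using (⊆-reflexive-↭; xs⊆xs++ys; xs⊆ys++xs)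
open import Data.List.Relation.Unary.All using (All; []; _∷_)
import Data.List.Relation.Unary.All.Properties as All
open import Data.List.Relation.Unary.Any using (Any; here; there)
import Data.List.Relation.Unary.Any.Properties as Any
open import Data.Product using (_×_; _,_)
open import Data.Sum using (_⊎_; inj₁; inj₂)
open import Data.Unit using (⊤; tt)
open import Relation.Binary.PropositionalEquality using (refl)

infix  3 _⟶_
infixr 9 _⨾_

_⟶_ : Formula → Formula → Set
A ⟶ B = ⊢WFĈ A ⇒ B

_⨾_ : ∀ {A B C} → A ⟶ B → B ⟶ C → A ⟶ C
_⨾_ = r-tr

∧-mono : ∀ {A A′ B B′} → A ⟶ A′ → B ⟶ B′ → A ∧ B ⟶ A′ ∧ B′
∧-mono f g = r-∧ (a-∧₁ ⨾ f) (a-∧₂ ⨾ g)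

∨-mono : ∀ {A A′ B B′} → A ⟶ A′ → B ⟶ B′ → A ∨ B ⟶ A′ ∨ B′
∨-mono f g = r-∨ (f ⨾ a-∨₁) (g ⨾ a-∨₂)

∧-comm : ∀ {A B} → A ∧ B ⟶ B ∧ A
∧-comm = r-∧ a-∧₂ a-∧₁

∧-assoc : ∀ {A B C} → (A ∧ B) ∧ C ⟶ A ∧ (B ∧ C)
∧-assoc = r-∧ (a-∧₁ ⨾ a-∧₁) (∧-mono a-∧₂ a-id)

∨-assoc : ∀ {A B C} → A ∨ (B ∨ C) ⟶ (A ∨ B) ∨ C
∨-assoc = r-∨ (a-∨₁ ⨾ a-∨₁) (∨-mono a-∨₂ a-id)

∧-distribʳ-∨ : ∀ {A B C} → (B ∨ C) ∧ A ⟶ (B ∧ A) ∨ (C ∧ A)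
∧-distribʳ-∨ = ∧-comm ⨾ a-dist ⨾ ∨-mono ∧-comm ∧-comm

∨-distribʳ-∧ : ∀ {A B D} → (A ∨ D) ∧ (B ∨ D) ⟶ (A ∧ B) ∨ D
∨-distribʳ-∧ =
  a-dist ⨾ r-∨ (∧-distribʳ-∨ ⨾ ∨-mono a-id a-∧₁) (a-∧₂ ⨾ a-∨₂)

-- A ⟶ B makes A and A ∧ B equivalent, so the congruence rule gives
-- (C → A) ⟶ (C → A ∧ B), which the Ĉ axiom splits.
⇒-monoʳ : ∀ {A B C} → A ⟶ B → C ⇒ A ⟶ C ⇒ B
⇒-monoʳ f = r-mp (r-⇔ (r-adj a-id a-id) (r-adj (r-∧ a-id f) a-∧₁)) a-∧₁ ⨾ a-Ĉ ⨾ a-∧₂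

⋀-∷⁻ : ∀ A Γ → ⋀ (A ∷ Γ) ⟶ A ∧ ⋀ Γ
⋀-∷⁻ A []      = r-∧ a-id (r-wk a-id)
⋀-∷⁻ A (_ ∷ _) = a-id

⋀-∷⁺ : ∀ A Γ → A ∧ ⋀ Γ ⟶ ⋀ (A ∷ Γ)
⋀-∷⁺ A []      = a-∧₁
⋀-∷⁺ A (_ ∷ _) = a-id

⋁-∷⁻ : ∀ A Δ → ⋁ (A ∷ Δ) ⟶ A ∨ ⋁ Δ
⋁-∷⁻ A []      = a-∨₁
⋁-∷⁻ A (_ ∷ _) = a-id

⋁-∷⁺ : ∀ A Δ → A ∨ ⋁ Δ ⟶ ⋁ (A ∷ Δ)
⋁-∷⁺ A []      = r-∨ a-id a-⊥
⋁-∷⁺ A (_ ∷ _) = a-id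

⋀-head : ∀ {A} Γ → ⋀ (A ∷ Γ) ⟶ A
⋀-head Γ = ⋀-∷⁻ _ Γ ⨾ a-∧₁

⋁-head : ∀ {A} Δ → A ⟶ ⋁ (A ∷ Δ)
⋁-head Δ = a-∨₁ ⨾ ⋁-∷⁺ _ Δ

⋀-proj : ∀ {Γ B} → B ∈ Γ → ⋀ Γ ⟶ B
⋀-proj {_ ∷ Γ} (here refl) = ⋀-head Γ
⋀-proj {A ∷ Γ} (there B∈Γ) = ⋀-∷⁻ A Γ ⨾ a-∧₂ ⨾ ⋀-proj B∈Γ

⋀-intro : ∀ Γ {X} → (∀ {B} → B ∈ Γ → X ⟶ B) → X ⟶ ⋀ Γ
⋀-intro []      f = r-wk a-id
⋀-intro (A ∷ Γ) f = r-∧ (f (here refl)) (⋀-intro Γ (λ B∈Γ → f (there B∈Γ))) ⨾ ⋀-∷⁺ A Γ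

⋁-inj : ∀ {Δ B} → B ∈ Δ → B ⟶ ⋁ Δ
⋁-inj {_ ∷ Δ} (here refl) = ⋁-head Δ
⋁-inj {A ∷ Δ} (there B∈Δ) = ⋁-inj B∈Δ ⨾ a-∨₂ ⨾ ⋁-∷⁺ A Δ

⋁-elim : ∀ Δ {Y} → (∀ {B} → B ∈ Δ → B ⟶ Y) → ⋁ Δ ⟶ Y
⋁-elim []      f = a-⊥
⋁-elim (A ∷ Δ) f = ⋁-∷⁻ A Δ ⨾ r-∨ (f (here refl)) (⋁-elim Δ (λ B∈Δ → f (there B∈Δ)))

⋀-⊇ : ∀ {Γ Γ′} → Γ′ ⊆ Γ → ⋀ Γ ⟶ ⋀ Γ′
⋀-⊇ {Γ′ = Γ′} Γ′⊆Γ = ⋀-intro Γ′ (λ B∈Γ′ → ⋀-proj (Γ′⊆Γ B∈Γ′))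

⋁-⊆ : ∀ {Δ Δ′} → Δ ⊆ Δ′ → ⋁ Δ ⟶ ⋁ Δ′
⋁-⊆ {Δ} Δ⊆Δ′ = ⋁-elim Δ (λ B∈Δ → ⋁-inj (Δ⊆Δ′ B∈Δ))

⋀-++⁻ : ∀ Γ Γ′ → ⋀ (Γ ++ Γ′) ⟶ ⋀ Γ ∧ ⋀ Γ′
⋀-++⁻ Γ Γ′ = r-∧ (⋀-⊇ (xs⊆xs++ys Γ Γ′)) (⋀-⊇ (xs⊆ys++xs Γ′ Γ))

⋁-++⁺ : ∀ Δ Δ′ → ⋁ Δ′ ∨ ⋁ Δ ⟶ ⋁ (Δ ++ Δ′)
⋁-++⁺ Δ Δ′ = r-∨ (⋁-⊆ (xs⊆ys++xs Δ′ Δ)) (⋁-⊆ (xs⊆xs++ys Δ Δ′))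

principal : ∀ {A B} Γ Δ → A ⟶ B → ⋀ (A ∷ Γ) ⟶ ⋁ (B ∷ Δ)
principal Γ Δ f = ⋀-head Γ ⨾ f ⨾ ⋁-head Δ

⊢G⇒⊢WFĈ : ∀ {Γ Δ} → Γ ⊢G Δ → ⋀ Γ ⟶ ⋁ Δ
⊢G⇒⊢WFĈ (perm Γ↭Γ′ Δ↭Δ′ d) =
  ⋀-⊇ (⊆-reflexive-↭ Γ↭Γ′) ⨾ ⊢G⇒⊢WFĈ d ⨾ ⋁-⊆ (⊆-reflexive-↭ Δ↭Δ′)
⊢G⇒⊢WFĈ (ax {Γ = Γ} {Δ}) = principal Γ Δ a-id
⊢G⇒⊢WFĈ (⊥L {Γ}) = ⋀-head Γ ⨾ a-⊥
⊢G⇒⊢WFĈ (∧L {A} {B} {Γ} d) =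
  ⋀-∷⁻ (A ∧ B) Γ ⨾ ∧-assoc ⨾ ∧-mono a-id (⋀-∷⁺ B Γ) ⨾ ⊢G⇒⊢WFĈ d
⊢G⇒⊢WFĈ (∧R {A} {B} {Δ = Δ} d e) =
  r-∧ (⊢G⇒⊢WFĈ d ⨾ ⋁-∷⁻ A Δ) (⊢G⇒⊢WFĈ e ⨾ ⋁-∷⁻ B Δ) ⨾ ∨-distribʳ-∧ ⨾ ⋁-∷⁺ (A ∧ B) Δ
⊢G⇒⊢WFĈ (∨L {A} {B} {Γ} d e) =
  ⋀-∷⁻ (A ∨ B) Γ ⨾ ∧-distribʳ-∨ ⨾ r-∨ (⋀-∷⁺ A Γ ⨾ ⊢G⇒⊢WFĈ d) (⋀-∷⁺ B Γ ⨾ ⊢G⇒⊢WFĈ e)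
⊢G⇒⊢WFĈ (∨R {A} {B} {Δ = Δ} d) =
  ⊢G⇒⊢WFĈ d ⨾ ∨-mono a-id (⋁-∷⁻ B Δ) ⨾ ∨-assoc ⨾ ⋁-∷⁺ (A ∨ B) Δ
⊢G⇒⊢WFĈ (⇒R {Δ = Δ} d) = r-wk (⊢G⇒⊢WFĈ d) ⨾ ⋁-head Δ
⊢G⇒⊢WFĈ (⇒LR {Γ = Γ} {Δ} ab ba cd dc) =
  principal Γ Δ (r-mp (r-⇔ (r-adj (⊢G⇒⊢WFĈ ab) (⊢G⇒⊢WFĈ ba))
                           (r-adj (⊢G⇒⊢WFĈ cd) (⊢G⇒⊢WFĈ dc)))
                      a-∧₁)
⊢G⇒⊢WFĈ (cut {D} {Γ} {Γ′} {Δ} {Δ′} d e) =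
  ⋀-++⁻ Γ Γ′ ⨾ ∧-mono (⊢G⇒⊢WFĈ d ⨾ ⋁-∷⁻ D Δ) a-id ⨾ ∧-distribʳ-∨
    ⨾ ∨-mono (⋀-∷⁺ D Γ′ ⨾ ⊢G⇒⊢WFĈ e) a-∧₁ ⨾ ⋁-++⁺ Δ Δ′
⊢G⇒⊢WFĈ (⇒Ĉ {Γ = Γ} {Δ} d) = principal Γ Δ (⇒-monoʳ (⊢G⇒⊢WFĈ d))

exchangeˡ : ∀ {A B Γ Δ} → B ∷ A ∷ Γ ⊢G Δ → A ∷ B ∷ Γ ⊢G Δ
exchangeˡ = perm (↭-swap _ _ ↭-refl) ↭-refl

exchangeʳ : ∀ {A B Γ Δ} → Γ ⊢G B ∷ A ∷ Δ → Γ ⊢G A ∷ B ∷ Δ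
exchangeʳ = perm ↭-refl (↭-swap _ _ ↭-refl)

identity : ∀ A {Γ Δ} → A ∷ Γ ⊢G A ∷ Δ
identity (atom p) = ax
identity ⊥'       = ⊥L
identity (A ∧ B)  = ∧L (∧R (identity A) (exchangeˡ (identity B)))
identity (A ∨ B)  = ∨L (∨R (identity A)) (∨R (exchangeʳ (identity B)))
identity (A ⇒ B)  = ⇒LR (identity A) (identity A) (identity B) (identity B)

cut₁ : ∀ {Γ D Δ} → Γ ⊢G D ∷ [] → D ∷ [] ⊢G Δ → Γ ⊢G Δ
cut₁ {Γ} d e = perm (++-identityʳ Γ) ↭-refl (cut d e)

weakenˡ : ∀ C {Γ D Δ} → Γ ⊢G D ∷ Δ → C ∷ Γ ⊢G D ∷ Δ
weakenˡ C {Γ} {D} {Δ} d =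
  perm (↭-sym (∷↭∷ʳ C Γ)) (↭-sym (∷↭∷ʳ D Δ)) (cut d (identity D {C ∷ []} {[]}))

weakenʳ : ∀ A {D Γ Δ} → D ∷ Γ ⊢G Δ → D ∷ Γ ⊢G A ∷ Δ
weakenʳ A {D} d = cut (identity D {[]} {A ∷ []}) d

⋀-right : ∀ Γ → Γ ⊢G ⋀ Γ ∷ []
⋀-right []          = ⇒R ⊥L
⋀-right (A ∷ [])    = identity A
⋀-right (A ∷ B ∷ Γ) = ∧R (identity A) (weakenˡ A (⋀-right (B ∷ Γ)))

⋁-left : ∀ Δ → ⋁ Δ ∷ [] ⊢G Δ
⋁-left []          = ⊥L
⋁-left (A ∷ [])    = identity A
⋁-left (A ∷ B ∷ Δ) = ∨L (identity A) (weakenʳ A (⋁-left (B ∷ Δ)))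

⟦_⟧ : Formula → Set
⟦ atom p ⟧ = ⊤
⟦ ⊥' ⟧     = Empty
⟦ A ∧ B ⟧  = ⟦ A ⟧ × ⟦ B ⟧
⟦ A ∨ B ⟧  = ⟦ A ⟧ ⊎ ⟦ B ⟧
⟦ A ⇒ B ⟧  = A ∷ [] ⊢G B ∷ []

realize : ∀ {Γ Δ} → Γ ⊢G Δ → All ⟦_⟧ Γ → Any ⟦_⟧ Δ
realize (perm Γ↭Γ′ Δ↭Δ′ d) ρ = Any-resp-↭ Δ↭Δ′ (realize d (All-resp-↭ (↭-sym Γ↭Γ′) ρ))
realize ax       ρ                 = here tt
realize ⊥L       (() ∷ _)
realize (∧L d)   ((a , b) ∷ ρ)     = realize d (a ∷ b ∷ ρ)
realize (∧R d e) ρ with realize d ρ | realize e ρ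
... | here a  | here b  = here (a , b)
... | here _  | there δ = there δ
... | there δ | _       = there δ
realize (∨L d e) (inj₁ a ∷ ρ)      = realize d (a ∷ ρ)
realize (∨L d e) (inj₂ b ∷ ρ)      = realize e (b ∷ ρ)
realize (∨R d)   ρ with realize d ρ
... | here a           = here (inj₁ a)
... | there (here b)   = here (inj₂ b)
... | there (there δ)  = there δ
realize (⇒R d)   ρ                 = here d
realize (⇒LR _ ba cd _) (ac ∷ _)   = here (cut₁ (cut₁ ba ac) cd)
realize (cut {Γ = Γ} {Δ = Δ} d e) ρ with All.++⁻ Γ ρ
... | ρ₁ , ρ₂ with realize d ρ₁
...   | here x  = Any.++⁺ʳ Δ (realize e (x ∷ ρ₂))
...   | there δ = Any.++⁺ˡ δ
realize (⇒Ĉ d)   (ca ∷ _)          = here (cut₁ ca d)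

realize-closed : ∀ {F} → [] ⊢G F ∷ [] → ⟦ F ⟧
realize-closed d with realize d []
... | here x = x

⇒-inversion : ∀ {A B} → [] ⊢G (A ⇒ B) ∷ [] → A ∷ [] ⊢G B ∷ []
⇒-inversion = realize-closed

⊢WFĈ⇒⊢G-closed : ∀ {F} → ⊢WFĈ F → [] ⊢G F ∷ []
⊢WFĈ⇒⊢G-closed (a-∨₁ {A})         = ⇒R (∨R (identity A))
⊢WFĈ⇒⊢G-closed (a-∨₂ {A} {B})     = ⇒R (∨R (exchangeʳ (identity B)))
⊢WFĈ⇒⊢G-closed (a-∧₁ {A})         = ⇒R (∧L (identity A))
⊢WFĈ⇒⊢G-closed (a-∧₂ {A} {B})     = ⇒R (∧L (exchangeˡ (identity B)))
⊢WFĈ⇒⊢G-closed (a-dist {A} {B} {C}) =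
  ⇒R (∧L (exchangeˡ (∨L (∨R (∧R (exchangeˡ (identity A)) (identity B)))
                        (∨R (exchangeʳ (∧R (exchangeˡ (identity A)) (identity C)))))))
⊢WFĈ⇒⊢G-closed (a-id {A})         = ⇒R (identity A)
⊢WFĈ⇒⊢G-closed a-⊥                = ⇒R ⊥L
⊢WFĈ⇒⊢G-closed (a-Ĉ {A} {B} {C})  =
  ⇒R (∧R (⇒Ĉ (∧L (identity B))) (⇒Ĉ (∧L (exchangeˡ (identity C)))))
⊢WFĈ⇒⊢G-closed (r-mp a ab)        = cut₁ (⊢WFĈ⇒⊢G-closed a) (⇒-inversion (⊢WFĈ⇒⊢G-closed ab))
⊢WFĈ⇒⊢G-closed (r-wk {B = B} a)   = ⇒R (weakenˡ B (⊢WFĈ⇒⊢G-closed a))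
⊢WFĈ⇒⊢G-closed (r-tr ab bc)       =
  ⇒R (cut₁ (⇒-inversion (⊢WFĈ⇒⊢G-closed ab)) (⇒-inversion (⊢WFĈ⇒⊢G-closed bc)))
⊢WFĈ⇒⊢G-closed (r-∧ ab ac)        =
  ⇒R (∧R (⇒-inversion (⊢WFĈ⇒⊢G-closed ab)) (⇒-inversion (⊢WFĈ⇒⊢G-closed ac)))
⊢WFĈ⇒⊢G-closed (r-∨ ac bc)        =
  ⇒R (∨L (⇒-inversion (⊢WFĈ⇒⊢G-closed ac)) (⇒-inversion (⊢WFĈ⇒⊢G-closed bc)))
⊢WFĈ⇒⊢G-closed (r-adj a b)        = ∧R (⊢WFĈ⇒⊢G-closed a) (⊢WFĈ⇒⊢G-closed b)
⊢WFĈ⇒⊢G-closed (r-⇔ A⇔B C⇔D)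
  with realize-closed (⊢WFĈ⇒⊢G-closed A⇔B) | realize-closed (⊢WFĈ⇒⊢G-closed C⇔D)
... | ab , ba | cd , dc = ∧R (⇒R (⇒LR ab ba cd dc)) (⇒R (⇒LR ba ab dc cd))

⊢WFĈ⇒⊢G : ∀ Γ Δ → ⋀ Γ ⟶ ⋁ Δ → Γ ⊢G Δ
⊢WFĈ⇒⊢G Γ Δ h = cut₁ (cut₁ (⋀-right Γ) (⇒-inversion (⊢WFĈ⇒⊢G-closed h))) (⋁-left Δ)

mainTheorem10 : (Γ Δ : List Formula) →
    ((Γ ⊢G Δ) → (⊢WFĈ ⋀ Γ ⇒ ⋁ Δ)) × ((⊢WFĈ ⋀ Γ ⇒ ⋁ Δ) → (Γ ⊢G Δ))
mainTheorem10 Γ Δ = ⊢G⇒⊢WFĈ , ⊢WFĈ⇒⊢G Γ Δ
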